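{- Let $M_1=(E_1,\mathcal{B}_1)$ and $M_2=(E_2,\mathcal{B}_2)$ be loopless matroids on disjoint ground sets. The direct sum $M_1\oplus M_2$ is uniformly dense if and only if $M_1$ and $M_2$ are both uniformly dense and $\rho(M_1)=\rho(M_2)=\rho(M_1\oplus M_2)$.
   Context: For a matroid $M=(E,\mathcal{B})$, $\operatorname{rank}(A)=\max_{B\in\mathcal{B}}|B\cap A|$, the density of nonempty $A$ is $\rho(A)=|A|/\operatorname{rank}(A)$, and $\rho(M)=\rho(E)$. $M$ is uniformly dense if $\rho(A)\le\rho(E)$ for every nonempty $A\subseteq E$. The direct sum is $M_1\oplus M_2=(E_1\cup E_2,\{B_1\cup B_2: B_1\in\mathcal{B}_1,B_2\in\mathcal{B}_2\})$. -}

module Defs where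

open import Data.Nat using (ℕ; _*_; _≤_)
open import Data.Fin using (Fin)
open import Data.Fin.Subset using (Subset; _∈_; _∉_; _∩_; _∪_; _-_; ⁅_⁆; ∣_∣; ⊤; Nonempty)
open import Data.Vec using (_++_)
open import Data.Product using (Σ; ∃; _×_; _,_)
open import Relation.Binary.PropositionalEquality using (_≡_)

record SetSystem (n : ℕ) : Set₁ where
  field
    Base : Subset n → Set
open SetSystem public

record IsMatroid {n : ℕ} (M : SetSystem n) : Set where
  field
    base-nonempty : ∃ λ B → Base M B
    base-exchange : ∀ B₁ B₂ → Base M B₁ → Base M B₂ →
                    ∀ x → x ∈ B₁ → x ∉ B₂ →
                    ∃ λ y → y ∈ B₂ × y ∉ B₁ × Base M ((B₁ - x) ∪ ⁅ y ⁆)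

-- A loop is an element lying in no basis; loopless = no loops.
Loopless : {n : ℕ} → SetSystem n → Set
Loopless {n} M = ∀ (e : Fin n) → ∃ λ B → Base M B × e ∈ B

HasRank : {n : ℕ} → SetSystem n → Subset n → ℕ → Set
HasRank M A r =
  (∃ λ B → Base M B × ∣ B ∩ A ∣ ≡ r) × (∀ B → Base M B → ∣ B ∩ A ∣ ≤ r)

-- ρ(A) ≤ ρ(E), i.e. |A|/rank(A) ≤ |E|/rank(E), cross-multiplied
-- (ranks are positive for nonempty sets in a loopless matroid).
UniformlyDense : {n : ℕ} → SetSystem n → Set
UniformlyDense {n} M =
  ∀ (A : Subset n) → Nonempty A → ∀ rA rE →
  HasRank M A rA → HasRank M ⊤ rE → ∣ A ∣ * rE ≤ n * rA

-- Direct sum: ground set Fin m ⊎ Fin n encoded as Fin (m + n)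
-- (first m elements from M₁, last n from M₂); bases are B₁ ∪ B₂.
_⊕_ : {m n : ℕ} → SetSystem m → SetSystem n → SetSystem (m Data.Nat.+ n)
Base (M₁ ⊕ M₂) B = ∃ λ B₁ → ∃ λ B₂ → Base M₁ B₁ × Base M₂ B₂ × B ≡ B₁ ++ B₂

module Submission where

open import Defs
open import Data.Bool using (_∧_)
open import Data.Nat using (ℕ; zero; suc; _+_; _*_; _≤_; z≤n; NonZero; >-nonZero; >-nonZero⁻¹)
open import Data.Nat.Properties
open import Data.Nat.Solver using (module +-*-Solver)
open import Data.Fin as Fin using (_↑ˡ_; _↑ʳ_)
open import Data.Fin.Subset using (Subset; ⊤; ⊥; _∩_; ∣_∣; Nonempty; inside; outside)
open import Data.Fin.Subset.Properties using (∈⊤; ∣⊤∣≡n; ∣⊥∣≡0; ∩-zeroʳ; nonempty?; Empty-unique)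
open import Data.Vec using ([]; _∷_; _++_; splitAt)
open import Data.Vec.Properties using (zipWith-++; lookup-++ˡ; lookup-++ʳ; []=⇒lookup; lookup⇒[]=)
open import Data.Product using (∃; _×_; _,_)
open import Function.Bundles using (_⇔_; mk⇔; Equivalence)
open import Relation.Nullary using (yes; no)
open import Relation.Binary.PropositionalEquality

-- Ranks add over the direct sum, so with r = r₁ + r₂ the density of E₁ ⊕ E₂ is
-- the mediant of ρ(M₁) and ρ(M₂).  If the sum is uniformly dense, then
-- ρ(E₁), ρ(E₂) ≤ ρ(E) forces both to equal the mediant, and every A ⊆ Eᵢ
-- satisfies ρ(A) ≤ ρ(E) = ρ(Eᵢ).  Conversely a set A₁ ∪ A₂ has
-- |A| = |A₁| + |A₂| and rank(A) = rank(A₁) + rank(A₂), so bounds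
-- ρ(Aᵢ) ≤ ρ(E) on the two parts add up to ρ(A) ≤ ρ(E).

∣++∣ : ∀ {m n} (X : Subset m) (Y : Subset n) → ∣ X ++ Y ∣ ≡ ∣ X ∣ + ∣ Y ∣
∣++∣ []            Y = refl
∣++∣ (outside ∷ X) Y = ∣++∣ X Y
∣++∣ (inside  ∷ X) Y = cong suc (∣++∣ X Y)

∣[B₁++B₂]∩[A₁++A₂]∣ : ∀ {m n} (B₁ A₁ : Subset m) (B₂ A₂ : Subset n) →
  ∣ (B₁ ++ B₂) ∩ (A₁ ++ A₂) ∣ ≡ ∣ B₁ ∩ A₁ ∣ + ∣ B₂ ∩ A₂ ∣
∣[B₁++B₂]∩[A₁++A₂]∣ B₁ A₁ B₂ A₂ =
  trans (cong ∣_∣ (zipWith-++ _∧_ B₁ B₂ A₁ A₂)) (∣++∣ (B₁ ∩ A₁) (B₂ ∩ A₂))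

⊤-++ : ∀ m n → ⊤ {m + n} ≡ ⊤ {m} ++ ⊤ {n}
⊤-++ zero    n = refl
⊤-++ (suc m) n = cong (inside ∷_) (⊤-++ m n)

⊤-nonempty : ∀ {n} .{{_ : NonZero n}} → Nonempty (⊤ {n})
⊤-nonempty {suc n} = Fin.zero , ∈⊤

nonempty-++ˡ : ∀ {m n} (X : Subset m) (Y : Subset n) → Nonempty X → Nonempty (X ++ Y)
nonempty-++ˡ {n = n} X Y (i , i∈X) =
  i ↑ˡ n , lookup⇒[]= _ (X ++ Y) (trans (lookup-++ˡ X Y i) ([]=⇒lookup i∈X))

nonempty-++ʳ : ∀ {m n} (X : Subset m) (Y : Subset n) → Nonempty Y → Nonempty (X ++ Y)
nonempty-++ʳ {m} X Y (i , i∈Y) =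
  m ↑ʳ i , lookup⇒[]= _ (X ++ Y) (trans (lookup-++ʳ X Y i) ([]=⇒lookup i∈Y))

HasRank-unique : ∀ {n} {M : SetSystem n} {A r s} → HasRank M A r → HasRank M A s → r ≡ s
HasRank-unique ((B , b , ∣B∩A∣≡r) , r-max) ((C , c , ∣C∩A∣≡s) , s-max) =
  ≤-antisym (subst (_≤ _) ∣B∩A∣≡r (s-max B b)) (subst (_≤ _) ∣C∩A∣≡s (r-max C c))

HasRank-⊥ : ∀ {n} {M : SetSystem n} → ∃ (Base M) → HasRank M ⊥ 0
HasRank-⊥ {n} (B , b) = (B , b , ∣B∩⊥∣≡0 B) , λ C _ → ≤-reflexive (∣B∩⊥∣≡0 C)
  where
  ∣B∩⊥∣≡0 : ∀ B → ∣ B ∩ ⊥ ∣ ≡ 0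
  ∣B∩⊥∣≡0 B = trans (cong ∣_∣ (∩-zeroʳ B)) (∣⊥∣≡0 n)

module _ {m n : ℕ} {M₁ : SetSystem m} {M₂ : SetSystem n} where

  HasRank-⊕ : ∀ {A₁ A₂ s₁ s₂} → HasRank M₁ A₁ s₁ → HasRank M₂ A₂ s₂ →
              HasRank (M₁ ⊕ M₂) (A₁ ++ A₂) (s₁ + s₂)
  HasRank-⊕ {A₁} {A₂} ((B₁ , b₁ , e₁) , max₁) ((B₂ , b₂ , e₂) , max₂) =
    (B₁ ++ B₂ , (B₁ , B₂ , b₁ , b₂ , refl) ,
       trans (∣[B₁++B₂]∩[A₁++A₂]∣ B₁ A₁ B₂ A₂) (cong₂ _+_ e₁ e₂)) ,
    λ { _ (C₁ , C₂ , c₁ , c₂ , refl) →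
          subst (_≤ _) (sym (∣[B₁++B₂]∩[A₁++A₂]∣ C₁ A₁ C₂ A₂))
                (+-mono-≤ (max₁ C₁ c₁) (max₂ C₂ c₂)) }

  -- A basis attaining rank(A₁ ∪ A₂) splits into bases attaining both ranks,
  -- since replacing either half by a better one would beat the maximum.
  HasRank-⊕⁻¹ : ∀ {A₁ A₂ s} → HasRank (M₁ ⊕ M₂) (A₁ ++ A₂) s →
                ∃ λ s₁ → ∃ λ s₂ → HasRank M₁ A₁ s₁ × HasRank M₂ A₂ s₂ × s ≡ s₁ + s₂
  HasRank-⊕⁻¹ {A₁} {A₂} {s} ((_ , (B₁ , B₂ , b₁ , b₂ , refl) , e) , max) =
    ∣ B₁ ∩ A₁ ∣ , ∣ B₂ ∩ A₂ ∣ ,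
    ((B₁ , b₁ , refl) , λ C c → +-cancelʳ-≤ _ _ _ (beats C B₂ c b₂)) ,
    ((B₂ , b₂ , refl) , λ C c → +-cancelˡ-≤ _ _ _ (beats B₁ C b₁ c)) ,
    s≡
    where
    s≡ : s ≡ ∣ B₁ ∩ A₁ ∣ + ∣ B₂ ∩ A₂ ∣
    s≡ = trans (sym e) (∣[B₁++B₂]∩[A₁++A₂]∣ B₁ A₁ B₂ A₂)
    beats : ∀ C₁ C₂ → Base M₁ C₁ → Base M₂ C₂ →
            ∣ C₁ ∩ A₁ ∣ + ∣ C₂ ∩ A₂ ∣ ≤ ∣ B₁ ∩ A₁ ∣ + ∣ B₂ ∩ A₂ ∣
    beats C₁ C₂ c₁ c₂ = subst₂ _≤_ (∣[B₁++B₂]∩[A₁++A₂]∣ C₁ A₁ C₂ A₂) s≡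
                                  (max (C₁ ++ C₂) (C₁ , C₂ , c₁ , c₂ , refl))

  HasRank-⊕-⊤ : ∀ {r₁ r₂} → HasRank M₁ ⊤ r₁ → HasRank M₂ ⊤ r₂ →
                HasRank (M₁ ⊕ M₂) ⊤ (r₁ + r₂)
  HasRank-⊕-⊤ h₁ h₂ = subst (λ E → HasRank (M₁ ⊕ M₂) E _) (sym (⊤-++ m n)) (HasRank-⊕ h₁ h₂)

record DensityAtMost {k} (M : SetSystem k) (N r : ℕ) : Set where
  constructor mkDensityAtMost
  field bound : ∀ A → Nonempty A → ∀ s → HasRank M A s → ∣ A ∣ * r ≤ N * s
open DensityAtMost

uniformlyDense⇔densityAtMost : ∀ {k} {M : SetSystem k} {r} → HasRank M ⊤ r →
  UniformlyDense M ⇔ DensityAtMost M k r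
uniformlyDense⇔densityAtMost {k} h = mk⇔
  (λ ud → mkDensityAtMost λ A ne s hA → ud A ne s _ hA h)
  (λ d A ne s rE hA hE →
     subst (λ r → ∣ A ∣ * r ≤ k * s) (HasRank-unique h hE) (bound d A ne s hA))

densityAtMost-any : ∀ {k} {M : SetSystem k} {N r} → DensityAtMost M N r →
  ∀ A s → HasRank M A s → ∣ A ∣ * r ≤ N * s
densityAtMost-any {k} d A s hA with nonempty? A
... | yes ne = bound d A ne s hA
... | no  ¬ne rewrite Empty-unique ¬ne | ∣⊥∣≡0 k = z≤n

densityAtMost-rescale : ∀ {k} {M : SetSystem k} {N r N' r'} .{{_ : NonZero N}} →
  N * r' ≡ N' * r → DensityAtMost M N r → DensityAtMost M N' r'
densityAtMost-rescale {N = N} {r} {N'} {r'} e d = mkDensityAtMost λ A ne s hA →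
  let a = ∣ A ∣ in *-cancelˡ-≤ N (begin
    N * (a * r')   ≡⟨ solve 3 (λ N a r' → N :* (a :* r') := a :* (N :* r')) refl N a r' ⟩
    a * (N * r')   ≡⟨ cong (a *_) e ⟩
    a * (N' * r)   ≡⟨ solve 3 (λ a N' r → a :* (N' :* r) := N' :* (a :* r)) refl a N' r ⟩
    N' * (a * r)   ≤⟨ *-monoʳ-≤ N' (bound d A ne s hA) ⟩
    N' * (N * s)   ≡⟨ solve 3 (λ N' N s → N' :* (N :* s) := N :* (N' :* s)) refl N' N s ⟩
    N * (N' * s)   ∎)
  where
  open ≤-Reasoning
  open +-*-Solver

module _ {m n : ℕ} {M₁ : SetSystem m} {M₂ : SetSystem n} {N r : ℕ} where

  densityAtMost-⊕ : DensityAtMost M₁ N r → DensityAtMost M₂ N r →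
                    DensityAtMost (M₁ ⊕ M₂) N r
  densityAtMost-⊕ d₁ d₂ = mkDensityAtMost bound⊕
    where
    open ≤-Reasoning
    bound⊕ : ∀ A → Nonempty A → ∀ s → HasRank (M₁ ⊕ M₂) A s → ∣ A ∣ * r ≤ N * s
    bound⊕ A _ s hA with splitAt m A
    ... | A₁ , A₂ , refl with HasRank-⊕⁻¹ {A₁ = A₁} {A₂} hA
    ... | s₁ , s₂ , hA₁ , hA₂ , refl = begin
      ∣ A₁ ++ A₂ ∣ * r          ≡⟨ cong (_* r) (∣++∣ A₁ A₂) ⟩
      (∣ A₁ ∣ + ∣ A₂ ∣) * r     ≡⟨ *-distribʳ-+ r ∣ A₁ ∣ ∣ A₂ ∣ ⟩
      ∣ A₁ ∣ * r + ∣ A₂ ∣ * r   ≤⟨ +-mono-≤ (densityAtMost-any d₁ A₁ s₁ hA₁)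
                                           (densityAtMost-any d₂ A₂ s₂ hA₂) ⟩
      N * s₁ + N * s₂           ≡⟨ *-distribˡ-+ N s₁ s₂ ⟨
      N * (s₁ + s₂)             ∎

  densityAtMost-⊕ˡ : ∃ (Base M₂) → DensityAtMost (M₁ ⊕ M₂) N r → DensityAtMost M₁ N r
  densityAtMost-⊕ˡ b₂ d = mkDensityAtMost λ A ne s hA →
    subst₂ (λ a s → a * r ≤ N * s) (∣A++⊥∣≡∣A∣ A) (+-identityʳ s)
      (bound d (A ++ ⊥) (nonempty-++ˡ A ⊥ ne) (s + 0) (HasRank-⊕ hA (HasRank-⊥ b₂)))
    where
    ∣A++⊥∣≡∣A∣ : ∀ A → ∣ A ++ ⊥ ∣ ≡ ∣ A ∣
    ∣A++⊥∣≡∣A∣ A = trans (∣++∣ A ⊥) (trans (cong (∣ A ∣ +_) (∣⊥∣≡0 n)) (+-identityʳ _))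

  densityAtMost-⊕ʳ : ∃ (Base M₁) → DensityAtMost (M₁ ⊕ M₂) N r → DensityAtMost M₂ N r
  densityAtMost-⊕ʳ b₁ d = mkDensityAtMost λ A ne s hA →
    subst (λ a → a * r ≤ N * s) (trans (∣++∣ (⊥ {m}) A) (cong (_+ ∣ A ∣) (∣⊥∣≡0 m)))
      (bound d (⊥ {m} ++ A) (nonempty-++ʳ ⊥ A ne) s (HasRank-⊕ (HasRank-⊥ b₁) hA))

x≤a⇒y≤b⇒x+y≡a+b⇒x≡a : ∀ {x y a b} → x ≤ a → y ≤ b → x + y ≡ a + b → x ≡ a
x≤a⇒y≤b⇒x+y≡a+b⇒x≡a {x} {y} {a} x≤a y≤b e =
  ≤-antisym x≤a (+-cancelʳ-≤ y a x (≤-trans (+-monoʳ-≤ a y≤b) (≤-reflexive (sym e))))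

-- m / r₁ = n / r₂ iff both equal the mediant (m + n) / (r₁ + r₂).
mediant-≡ : ∀ m n r₁ r₂ → m * r₂ ≡ n * r₁ → m * (r₁ + r₂) ≡ (m + n) * r₁
mediant-≡ m n r₁ r₂ e = begin
  m * (r₁ + r₂)     ≡⟨ *-distribˡ-+ m r₁ r₂ ⟩
  m * r₁ + m * r₂   ≡⟨ cong (m * r₁ +_) e ⟩
  m * r₁ + n * r₁   ≡⟨ *-distribʳ-+ r₁ m n ⟨
  (m + n) * r₁      ∎
  where open ≡-Reasoning

mediant-≡⁻¹ : ∀ m n r₁ r₂ → m * (r₁ + r₂) ≡ (m + n) * r₁ → m * r₂ ≡ n * r₁
mediant-≡⁻¹ m n r₁ r₂ e = +-cancelˡ-≡ (m * r₁) _ _ (begin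
  m * r₁ + m * r₂   ≡⟨ *-distribˡ-+ m r₁ r₂ ⟨
  m * (r₁ + r₂)     ≡⟨ e ⟩
  (m + n) * r₁      ≡⟨ *-distribʳ-+ r₁ m n ⟩
  m * r₁ + n * r₁   ∎)
  where open ≡-Reasoning

mediant-≡ʳ : ∀ m n r₁ r₂ → m * r₂ ≡ n * r₁ → n * (r₁ + r₂) ≡ (m + n) * r₂
mediant-≡ʳ m n r₁ r₂ e =
  subst₂ (λ r k → n * r ≡ k * r₂) (+-comm r₂ r₁) (+-comm n m) (mediant-≡ n m r₂ r₁ (sym e))

module _ {m n : ℕ} .{{_ : NonZero m}} .{{_ : NonZero n}}
         {M₁ : SetSystem m} {M₂ : SetSystem n} {r₁ r₂ : ℕ}
         (b₁ : ∃ (Base M₁)) (b₂ : ∃ (Base M₂))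
         (h₁ : HasRank M₁ ⊤ r₁) (h₂ : HasRank M₂ ⊤ r₂) where

  private
    r = r₁ + r₂
    h : HasRank (M₁ ⊕ M₂) ⊤ r
    h = HasRank-⊕-⊤ h₁ h₂
    instance
      m+n≢0 : NonZero (m + n)
      m+n≢0 = >-nonZero (≤-trans (>-nonZero⁻¹ m) (m≤m+n m n))

  ⊕-uniformlyDense⇒ : UniformlyDense (M₁ ⊕ M₂) →
    UniformlyDense M₁ × UniformlyDense M₂ × m * r₂ ≡ n * r₁ × m * r ≡ (m + n) * r₁
  ⊕-uniformlyDense⇒ ud = dense₁ , dense₂ , cross , mediant₁
    where
    d : DensityAtMost (M₁ ⊕ M₂) (m + n) r
    d = Equivalence.to (uniformlyDense⇔densityAtMost h) ud
    d₁ : DensityAtMost M₁ (m + n) r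
    d₁ = densityAtMost-⊕ˡ b₂ d
    d₂ : DensityAtMost M₂ (m + n) r
    d₂ = densityAtMost-⊕ʳ b₁ d
    E₁-bound : m * r ≤ (m + n) * r₁
    E₁-bound = subst (λ a → a * r ≤ (m + n) * r₁) (∣⊤∣≡n m) (bound d₁ ⊤ ⊤-nonempty r₁ h₁)
    E₂-bound : n * r ≤ (m + n) * r₂
    E₂-bound = subst (λ a → a * r ≤ (m + n) * r₂) (∣⊤∣≡n n) (bound d₂ ⊤ ⊤-nonempty r₂ h₂)
    mediant₁ : m * r ≡ (m + n) * r₁
    mediant₁ = x≤a⇒y≤b⇒x+y≡a+b⇒x≡a E₁-bound E₂-bound
      (trans (sym (*-distribʳ-+ r m n)) (*-distribˡ-+ (m + n) r₁ r₂))
    cross : m * r₂ ≡ n * r₁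
    cross = mediant-≡⁻¹ m n r₁ r₂ mediant₁
    dense₁ : UniformlyDense M₁
    dense₁ = Equivalence.from (uniformlyDense⇔densityAtMost h₁)
               (densityAtMost-rescale (sym mediant₁) d₁)
    dense₂ : UniformlyDense M₂
    dense₂ = Equivalence.from (uniformlyDense⇔densityAtMost h₂)
               (densityAtMost-rescale (sym (mediant-≡ʳ m n r₁ r₂ cross)) d₂)

  ⊕-uniformlyDense⇐ : UniformlyDense M₁ → UniformlyDense M₂ → m * r₂ ≡ n * r₁ →
                      UniformlyDense (M₁ ⊕ M₂)
  ⊕-uniformlyDense⇐ ud₁ ud₂ cross =
    Equivalence.from (uniformlyDense⇔densityAtMost h) (densityAtMost-⊕
      (densityAtMost-rescale (mediant-≡ m n r₁ r₂ cross)
        (Equivalence.to (uniformlyDense⇔densityAtMost h₁) ud₁))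
      (densityAtMost-rescale (mediant-≡ʳ m n r₁ r₂ cross)
        (Equivalence.to (uniformlyDense⇔densityAtMost h₂) ud₂)))

theorem2p9 : ∀ {m n : ℕ} (M₁ : SetSystem m) (M₂ : SetSystem n) →
    IsMatroid M₁ → IsMatroid M₂ → Loopless M₁ → Loopless M₂ →
    1 ≤ m → 1 ≤ n →
    ∀ r₁ r₂ r → HasRank M₁ ⊤ r₁ → HasRank M₂ ⊤ r₂ → HasRank (M₁ ⊕ M₂) ⊤ r →
    UniformlyDense (M₁ ⊕ M₂) ⇔
      (UniformlyDense M₁ × UniformlyDense M₂ ×
       m * r₂ ≡ n * r₁ × m * r ≡ (m + n) * r₁)
theorem2p9 {m} {n} M₁ M₂ mat₁ mat₂ _ _ 1≤m 1≤n r₁ r₂ r h₁ h₂ h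
  rewrite HasRank-unique h (HasRank-⊕-⊤ h₁ h₂) = mk⇔
    (⊕-uniformlyDense⇒ b₁ b₂ h₁ h₂)
    (λ (ud₁ , ud₂ , cross , _) → ⊕-uniformlyDense⇐ b₁ b₂ h₁ h₂ ud₁ ud₂ cross)
  where
  open IsMatroid
  instance
    m≢0 : NonZero m
    m≢0 = >-nonZero 1≤m
    n≢0 : NonZero n
    n≢0 = >-nonZero 1≤n
  b₁ : ∃ (Base M₁)
  b₁ = base-nonempty mat₁
  b₂ : ∃ (Base M₂)
  b₂ = base-nonempty mat₂
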